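{- For every $n\ge 2$, the number $c_n$ of connected zigzag stacks on $[n]$ equals $n-1$.
   Context: $[n]=\{1,\dots,n\}$. A diagram on $[n]$ is a simple graph on vertex set $[n]$, vertices drawn in increasing order on a line; an edge $\{i,j\}$ with $i<j$ is an arc $(i,j)$. Arcs $(i_1,j_1),(i_2,j_2)$ cross if $i_1<i_2<j_1<j_2$; a stack is a diagram without crossing arcs. For a vertex $v$, $\mathrm{ld}(v)$ (resp. $\mathrm{rd}(v)$) is the number of arcs $(i,v)$ with $i<v$ (resp. $(v,j)$ with $j>v$), and $\deg(v)=\mathrm{ld}(v)+\mathrm{rd}(v)$. A zigzag stack is a stack in which every vertex has degree at most $2$ and no vertex $v$ has both $\mathrm{ld}(v)>0$ and $\mathrm{rd}(v)>0$. A diagram is connected if it is connected as a graph. -}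

module Defs where

-- Diagrams on [n] = {1,…,n}, encoded as lists of arcs (i , j) with i < j.
-- The set of all diagrams on [n] is enumerated as the list of all sublists
-- of the duplicate-free list of all possible arcs, so each simple graph on
-- [n] occurs exactly once.

open import Data.Nat using (ℕ; zero; suc; _+_; _<ᵇ_; _≡ᵇ_; _∸_)
open import Data.Bool using (Bool; true; false; _∧_; _∨_; not)
open import Data.Product using (_×_; _,_; proj₁; proj₂)
open import Data.List using (List; []; _∷_; map; _++_; concatMap; filterᵇ; upTo; length)
open import Data.Bool.ListAction using (all; any)

vertices : ℕ → List ℕ
vertices n = map suc (upTo n)

Arc : Set
Arc = ℕ × ℕ

allArcs : ℕ → List Arc
allArcs n = concatMap (λ i → map (λ j → (i , j)) (filterᵇ (λ j → i <ᵇ j) (vertices n))) (vertices n)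

sublists : {A : Set} → List A → List (List A)
sublists []       = [] ∷ []
sublists (x ∷ xs) = let r = sublists xs in r ++ map (x ∷_) r

Diagram : Set
Diagram = List Arc

diagrams : ℕ → List Diagram
diagrams n = sublists (allArcs n)

crossᵇ : Arc → Arc → Bool
crossᵇ (i₁ , j₁) (i₂ , j₂) = (i₁ <ᵇ i₂) ∧ (i₂ <ᵇ j₁) ∧ (j₁ <ᵇ j₂)

isStack : Diagram → Bool
isStack D = all (λ a → all (λ b → not (crossᵇ a b)) D) D

count : {A : Set} → (A → Bool) → List A → ℕ
count p xs = length (filterᵇ p xs)

ld : Diagram → ℕ → ℕ
ld D v = count (λ a → proj₂ a ≡ᵇ v) D

rd : Diagram → ℕ → ℕ
rd D v = count (λ a → proj₁ a ≡ᵇ v) D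

deg : Diagram → ℕ → ℕ
deg D v = ld D v + rd D v

positive : ℕ → Bool
positive m = 0 <ᵇ m

isZigzagStack : ℕ → Diagram → Bool
isZigzagStack n D =
  isStack D ∧
  all (λ v → (deg D v <ᵇ 3) ∧ not (positive (ld D v) ∧ positive (rd D v))) (vertices n)

memᵇ : ℕ → List ℕ → Bool
memᵇ v = any (λ w → w ≡ᵇ v)

adjacentᵇ : Diagram → ℕ → ℕ → Bool
adjacentᵇ D u v = any (λ a → ((proj₁ a ≡ᵇ u) ∧ (proj₂ a ≡ᵇ v)) ∨ ((proj₁ a ≡ᵇ v) ∧ (proj₂ a ≡ᵇ u))) D

expand : ℕ → Diagram → List ℕ → List ℕ
expand n D S = filterᵇ (λ v → memᵇ v S ∨ any (λ u → adjacentᵇ D u v) S) (vertices n)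

iter : ℕ → (List ℕ → List ℕ) → List ℕ → List ℕ
iter zero    f S = S
iter (suc k) f S = iter k f (f S)

-- vertices reachable from vertex 1 (n steps suffice)
reachFrom1 : ℕ → Diagram → List ℕ
reachFrom1 n D = iter n (expand n D) (1 ∷ [])

isConnected : ℕ → Diagram → Bool
isConnected n D = all (λ v → memᵇ v (reachFrom1 n D)) (vertices n)

c : ℕ → ℕ
c n = count (λ D → isConnected n D ∧ isZigzagStack n D) (diagrams n)

{-# OPTIONS --safe #-}
module Submission where

-- Every connected zigzag stack on [n], n ≥ 2, contains the arc (1 , n). Let a be the other
-- neighbour of 1 (a = 1 if there is none). Below an arc (l , r) whose left end has no arc into
-- (l , r), the diagram is forced to be the spiral l – r – (l+1) – (r−1) – ⋯, i.e. its arcs on [l, r]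
-- are those with x + y ∈ {l + r, l + r + 1}: connectivity lets the interior escape only through an
-- arc (c , r), noncrossing and the degree bound force c = l + 1, and then the roles of the two ends
-- swap. This gives a spiral on [1, a]; in the same way (a + 1 , n) is an arc, giving a spiral on
-- [a+1, n], and no arc other than (1 , n) crosses the gap between a and a + 1. Conversely each of
-- these n − 1 diagrams is a connected zigzag stack, and they are pairwise distinct.

open import Defs
open import Data.Bool using (Bool; true; false; T; _∧_; _∨_; not)
open import Data.Bool.ListAction using (all; any)
open import Data.Bool.Properties using (T-∧; T-∨)
open import Data.Empty using (⊥; ⊥-elim)
open import Data.List using (List; []; _∷_; map; filter; filterᵇ; length; applyUpTo)
open import Data.List.Membership.Propositional using (_∈_; _∉_; find; lose)
open import Data.List.Membership.Propositional.Properties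
  using (∈-map⁺; ∈-map⁻; ∈-++⁺ˡ; ∈-++⁺ʳ; ∈-++⁻; ∈-filter⁺; ∈-filter⁻; ∈-upTo⁺; ∈-upTo⁻;
         ∈-applyUpTo⁺; ∈-applyUpTo⁻; ∈-concatMap⁺; ∈-concatMap⁻)
open import Data.List.Properties using (length-removeAt′; filter-none; ∷-injectiveʳ; length-applyUpTo)
open import Data.List.Relation.Binary.Subset.Propositional using (_⊆_)
open import Data.List.Relation.Unary.All as All using (All; []; _∷_)
import Data.List.Relation.Unary.All.Properties as All
open import Data.List.Relation.Unary.AllPairs as AllPairs using ([]; _∷_)
import Data.List.Relation.Unary.AllPairs.Properties as AllPairs
open import Data.List.Relation.Unary.Any as Any using (Any; here; there; index; _─_; any?)
open import Data.List.Relation.Unary.Any.Properties using (any⁺; any⁻)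
open import Data.List.Relation.Unary.Unique.Propositional using (Unique)
import Data.List.Relation.Unary.Unique.Propositional.Properties as Unique
open import Data.Nat
  using (ℕ; zero; suc; _+_; _∸_; _≤_; _<_; z≤n; s≤s; z<s; _<ᵇ_; _≡ᵇ_; _≟_; _≤?_; _<?_)
open import Data.Nat.Properties
open import Data.Product using (_×_; _,_; proj₁; proj₂; ∃-syntax; ∃₂)
open import Data.Product.Properties using (≡-dec)
open import Data.Sum as Sum using (_⊎_; inj₁; inj₂)
open import Function using (_∘_; _⇔_; mk⇔; Equivalence)
open import Relation.Binary.Definitions using (DecidableEquality)
open import Relation.Binary.PropositionalEquality
open import Relation.Nullary using (¬_; Dec; does; contradiction; yes; no)
open import Relation.Nullary.Decidable using (T?; _×-dec_; _⊎-dec_)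
open import Relation.Unary using (Decidable)

private variable
  A : Set
  x y z u w : A
  xs ys : List A

∈-─⁺ : (x∈ys : x ∈ ys) → z ∈ ys → z ≢ x → z ∈ (ys ─ x∈ys)
∈-─⁺ (here refl) (here refl)  z≢x = contradiction refl z≢x
∈-─⁺ (here refl) (there z∈ys) _   = z∈ys
∈-─⁺ (there _)   (here refl)  _   = here refl
∈-─⁺ (there x∈ys) (there z∈ys) z≢x = there (∈-─⁺ x∈ys z∈ys z≢x)

unique-⊆⇒length≤ : Unique xs → xs ⊆ ys → length xs ≤ length ys
unique-⊆⇒length≤ {xs = []} _ _ = z≤n
unique-⊆⇒length≤ {xs = x ∷ xs} {ys} (x∉xs ∷ uxs) xs⊆ys = begin
  suc (length xs)          ≤⟨ s≤s (unique-⊆⇒length≤ uxs xs⊆ys─x) ⟩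
  suc (length (ys ─ x∈ys)) ≡⟨ length-removeAt′ ys (index x∈ys) ⟨
  length ys                ∎
  where
  open ≤-Reasoning
  x∈ys = xs⊆ys (here refl)
  xs⊆ys─x : xs ⊆ (ys ─ x∈ys)
  xs⊆ys─x z∈xs = ∈-─⁺ x∈ys (xs⊆ys (there z∈xs)) (≢-sym (All.lookup x∉xs z∈xs))

unique-⊆⊇⇒length≡ : Unique xs → Unique ys → xs ⊆ ys → ys ⊆ xs → length xs ≡ length ys
unique-⊆⊇⇒length≡ uxs uys xs⊆ys ys⊆xs =
  ≤-antisym (unique-⊆⇒length≤ uxs xs⊆ys) (unique-⊆⇒length≤ uys ys⊆xs)

module _ (p : A → Bool) where

  ∈-filterᵇ⁺ : x ∈ xs → T (p x) → x ∈ filterᵇ p xs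
  ∈-filterᵇ⁺ = ∈-filter⁺ (T? ∘ p)

  ∈-filterᵇ⁻ : ∀ xs → x ∈ filterᵇ p xs → x ∈ xs × T (p x)
  ∈-filterᵇ⁻ xs = ∈-filter⁻ (T? ∘ p) {xs = xs}

  count-≡0 : (∀ {x} → x ∈ xs → ¬ T (p x)) → count p xs ≡ 0
  count-≡0 ¬p = cong length (filter-none (T? ∘ p) (All.tabulate ¬p))

  count-≥ : Unique ys → ys ⊆ xs → All (T ∘ p) ys → length ys ≤ count p xs
  count-≥ uys ys⊆xs pys =
    unique-⊆⇒length≤ uys (λ y∈ys → ∈-filterᵇ⁺ (ys⊆xs y∈ys) (All.lookup pys y∈ys))

  count<3⇒≡⊎≡ : DecidableEquality A → count p xs < 3 → x ∈ xs → y ∈ xs → z ∈ xs →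
                T (p x) → T (p y) → T (p z) → x ≢ y → z ≡ x ⊎ z ≡ y
  count<3⇒≡⊎≡ {xs = xs} {x} {y} {z} _≟_ count<3 x∈xs y∈xs z∈xs px py pz x≢y
    with z ≟ x | z ≟ y
  ... | yes z≡x | _       = inj₁ z≡x
  ... | no _    | yes z≡y = inj₂ z≡y
  ... | no z≢x  | no z≢y  =
    ⊥-elim (<⇒≱ count<3 (count-≥ {xs = xs} distinct xyz⊆xs (px ∷ py ∷ pz ∷ [])))
    where
    distinct : Unique (x ∷ y ∷ z ∷ [])
    distinct = (x≢y ∷ ≢-sym z≢x ∷ []) ∷ (≢-sym z≢y ∷ []) ∷ [] ∷ []
    xyz⊆xs : x ∷ y ∷ z ∷ [] ⊆ xs
    xyz⊆xs (here refl)                 = x∈xs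
    xyz⊆xs (there (here refl))         = y∈xs
    xyz⊆xs (there (there (here refl))) = z∈xs

  count-≤2 : Unique xs → (∀ {x} → x ∈ xs → T (p x) → x ≡ u ⊎ x ≡ w) → count p xs ≤ 2
  count-≤2 {xs = xs} {u} {w} uxs two = unique-⊆⇒length≤ (Unique.filter⁺ (T? ∘ p) uxs) ⊆uw
    where
    ⊆uw : filterᵇ p xs ⊆ u ∷ w ∷ []
    ⊆uw x∈ with ∈-filterᵇ⁻ xs x∈
    ... | x∈xs , px with two x∈xs px
    ...   | inj₁ refl = here refl
    ...   | inj₂ refl = there (here refl)

module _ {A : Set} where

  private variable
    L D D′ : List A

  ∈-sublists⁻ : ∀ x L → D ∈ sublists (x ∷ L) →
                D ∈ sublists L ⊎ ∃[ D₀ ] (D₀ ∈ sublists L × D ≡ x ∷ D₀)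
  ∈-sublists⁻ x L D∈ with ∈-++⁻ (sublists L) D∈
  ... | inj₁ D∈L  = inj₁ D∈L
  ... | inj₂ D∈xL = inj₂ (∈-map⁻ (x ∷_) D∈xL)

  ∈-sublists⇒⊆ : ∀ L → D ∈ sublists L → D ⊆ L
  ∈-sublists⇒⊆ []      (here refl) ()
  ∈-sublists⇒⊆ (x ∷ L) D∈ e∈D with ∈-sublists⁻ x L D∈
  ... | inj₁ D∈L                  = there (∈-sublists⇒⊆ L D∈L e∈D)
  ... | inj₂ (D₀ , D₀∈L , refl) with e∈D
  ...   | here refl = here refl
  ...   | there e∈D₀ = there (∈-sublists⇒⊆ L D₀∈L e∈D₀)

  ∉-sublists : ∀ {x} L → All (x ≢_) L → D ∈ sublists L → x ∉ D
  ∉-sublists L x∉L D∈L x∈D = All.lookup x∉L (∈-sublists⇒⊆ L D∈L x∈D) refl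

  sublists-unique : Unique L → Unique (sublists L)
  sublists-unique {[]}    _           = [] ∷ []
  sublists-unique {x ∷ L} (x∉L ∷ uL) =
    Unique.++⁺ (sublists-unique uL) (Unique.map⁺ ∷-injectiveʳ (sublists-unique uL)) disjoint
    where
    disjoint : ∀ {D} → D ∈ sublists L × D ∈ map (x ∷_) (sublists L) → ⊥
    disjoint (D∈L , D∈xL) with ∈-map⁻ (x ∷_) D∈xL
    ... | _ , _ , refl = ∉-sublists L x∉L D∈L (here refl)

  filter∈sublists : ∀ {P : A → Set} (P? : Decidable P) L → filter P? L ∈ sublists L
  filter∈sublists P? []      = here refl
  filter∈sublists P? (x ∷ L) with does (P? x)
  ... | true  = ∈-++⁺ʳ (sublists L) (∈-map⁺ (x ∷_) (filter∈sublists P? L))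
  ... | false = ∈-++⁺ˡ (filter∈sublists P? L)

  sublists-ext : Unique L → D ∈ sublists L → D′ ∈ sublists L → D ⊆ D′ → D′ ⊆ D → D ≡ D′
  sublists-ext {[]} _ (here refl) (here refl) _ _ = refl
  sublists-ext {x ∷ L} (x∉L ∷ uL) D∈ D′∈ D⊆D′ D′⊆D
    with ∈-sublists⁻ x L D∈ | ∈-sublists⁻ x L D′∈
  ... | inj₁ D∈L | inj₁ D′∈L = sublists-ext uL D∈L D′∈L D⊆D′ D′⊆D
  ... | inj₁ D∈L | inj₂ (_ , _ , refl) = ⊥-elim (∉-sublists L x∉L D∈L (D′⊆D (here refl)))
  ... | inj₂ (_ , _ , refl) | inj₁ D′∈L = ⊥-elim (∉-sublists L x∉L D′∈L (D⊆D′ (here refl)))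
  ... | inj₂ (D₀ , D₀∈L , refl) | inj₂ (D₀′ , D₀′∈L , refl) =
    cong (x ∷_) (sublists-ext uL D₀∈L D₀′∈L (strip D₀∈L D⊆D′) (strip D₀′∈L D′⊆D))
    where
    strip : ∀ {D₁ D₂} → D₁ ∈ sublists L → x ∷ D₁ ⊆ x ∷ D₂ → D₁ ⊆ D₂
    strip D₁∈L ⊆ e∈D₁ with ⊆ (there e∈D₁)
    ... | there e∈D₂ = e∈D₂
    ... | here refl  = ⊥-elim (∉-sublists L x∉L D₁∈L e∈D₁)

private variable
  n i j v : ℕ

IsVertex : ℕ → ℕ → Set
IsVertex n v = 1 ≤ v × v ≤ n

IsArc : ℕ → Arc → Set
IsArc n (i , j) = 1 ≤ i × i < j × j ≤ n

∈-vertices⁺ : IsVertex n v → v ∈ vertices n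
∈-vertices⁺ {v = suc v} (_ , v<n) = ∈-map⁺ suc (∈-upTo⁺ v<n)

∈-vertices⁻ : v ∈ vertices n → IsVertex n v
∈-vertices⁻ v∈ with ∈-map⁻ suc v∈
... | _ , k∈ , refl = s≤s z≤n , ∈-upTo⁻ k∈

vertices-unique : ∀ n → Unique (vertices n)
vertices-unique n = Unique.map⁺ suc-injective (Unique.upTo⁺ n)

private
  row : ℕ → ℕ → List Arc
  row n i = map (i ,_) (filterᵇ (i <ᵇ_) (vertices n))

  ∈-row⁻ : ∀ {e} → e ∈ row n i → proj₁ e ≡ i
  ∈-row⁻ e∈ with ∈-map⁻ _ e∈
  ... | _ , _ , refl = refl

∈-allArcs⁺ : IsArc n (i , j) → (i , j) ∈ allArcs n
∈-allArcs⁺ {n} {i} {j} (1≤i , i<j , j≤n) =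
  ∈-concatMap⁺ (row n) (lose (∈-vertices⁺ (1≤i , ≤-trans (<⇒≤ i<j) j≤n)) (∈-map⁺ (i ,_) j∈row))
  where
  j∈row : j ∈ filterᵇ (i <ᵇ_) (vertices n)
  j∈row = ∈-filterᵇ⁺ (i <ᵇ_) (∈-vertices⁺ (≤-trans (s≤s z≤n) i<j , j≤n)) (<⇒<ᵇ i<j)

∈-allArcs⁻ : ∀ {e} → e ∈ allArcs n → IsArc n e
∈-allArcs⁻ {n} e∈ with find (∈-concatMap⁻ (row n) {xs = vertices n} e∈)
... | i , i∈ , e∈row with ∈-map⁻ (i ,_) e∈row
... | j , j∈ , refl with ∈-filterᵇ⁻ (i <ᵇ_) (vertices n) j∈
... | j∈′ , i<ᵇj = proj₁ (∈-vertices⁻ i∈) , <ᵇ⇒< i j i<ᵇj , proj₂ (∈-vertices⁻ j∈′)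

allArcs-unique : ∀ n → Unique (allArcs n)
allArcs-unique n = Unique.concat⁺ (All.map⁺ (All.tabulate λ _ → unique-row))
  (AllPairs.map⁺ (AllPairs.map disjoint-rows (vertices-unique n)))
  where
  unique-row : Unique (row n i)
  unique-row = Unique.map⁺ (cong proj₂) (Unique.filter⁺ _ (vertices-unique n))
  disjoint-rows : i ≢ j → ∀ {e} → e ∈ row n i × e ∈ row n j → ⊥
  disjoint-rows i≢j (e∈i , e∈j) = i≢j (trans (sym (∈-row⁻ {n} e∈i)) (∈-row⁻ {n} e∈j))

T-not : ∀ {b} → T (not b) ⇔ (¬ T b)
T-not {true}  = mk⇔ (λ ()) (λ ¬t → ¬t _)
T-not {false} = mk⇔ (λ _ ()) _

pair-≡ᵇ⁻ : ∀ {a b u v} → T ((a ≡ᵇ u) ∧ (b ≡ᵇ v)) → (a , b) ≡ (u , v)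
pair-≡ᵇ⁻ {a} {b} {u} {v} t with Equivalence.to T-∧ t
... | a≡u , b≡v = cong₂ _,_ (≡ᵇ⇒≡ a u a≡u) (≡ᵇ⇒≡ b v b≡v)

pair-≡ᵇ⁺ : ∀ u v → T ((u ≡ᵇ u) ∧ (v ≡ᵇ v))
pair-≡ᵇ⁺ u v = Equivalence.from T-∧ (≡⇒≡ᵇ u u refl , ≡⇒≡ᵇ v v refl)

private variable
  k m : ℕ
  D : Diagram
  S : List ℕ

memᵇ⁻ : T (memᵇ v S) → v ∈ S
memᵇ⁻ t = Any.map (λ w≡ᵇv → sym (≡ᵇ⇒≡ _ _ w≡ᵇv)) (any⁻ _ _ t)

memᵇ⁺ : v ∈ S → T (memᵇ v S)
memᵇ⁺ {v} v∈S = any⁺ _ (Any.map (λ { refl → ≡⇒≡ᵇ v v refl }) v∈S)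

Adjacent : Diagram → ℕ → ℕ → Set
Adjacent D u v = (u , v) ∈ D ⊎ (v , u) ∈ D

adjacentᵇ⁻ : ∀ {u} → T (adjacentᵇ D u v) → Adjacent D u v
adjacentᵇ⁻ t with find (any⁻ _ _ t)
... | e , e∈D , te with Equivalence.to T-∨ te
...   | inj₁ e≡uv = inj₁ (subst (_∈ _) (pair-≡ᵇ⁻ e≡uv) e∈D)
...   | inj₂ e≡vu = inj₂ (subst (_∈ _) (pair-≡ᵇ⁻ e≡vu) e∈D)

adjacentᵇ⁺ : ∀ {u} → Adjacent D u v → T (adjacentᵇ D u v)
adjacentᵇ⁺ {v = v} {u} (inj₁ uv∈D) =
  any⁺ _ (lose uv∈D (Equivalence.from T-∨ (inj₁ (pair-≡ᵇ⁺ u v))))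
adjacentᵇ⁺ {v = v} {u} (inj₂ vu∈D) =
  any⁺ _ (lose vu∈D (Equivalence.from T-∨ (inj₂ (pair-≡ᵇ⁺ v u))))

Expansion : Diagram → List ℕ → ℕ → Set
Expansion D S v = v ∈ S ⊎ ∃[ u ] (u ∈ S × Adjacent D u v)

private
  expansionᵇ : Diagram → List ℕ → ℕ → Bool
  expansionᵇ D S v = memᵇ v S ∨ any (λ u → adjacentᵇ D u v) S

∈-expand⁻ : v ∈ expand n D S → Expansion D S v
∈-expand⁻ {n = n} {D = D} {S} v∈
  with Equivalence.to T-∨ (proj₂ (∈-filterᵇ⁻ (expansionᵇ D S) (vertices n) v∈))
... | inj₁ v∈S = inj₁ (memᵇ⁻ v∈S)
... | inj₂ adj with find (any⁻ _ _ adj)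
...   | u , u∈S , u~v = inj₂ (u , u∈S , adjacentᵇ⁻ u~v)

∈-expand⁺ : IsVertex n v → Expansion D S v → v ∈ expand n D S
∈-expand⁺ {D = D} {S} v∈[n] ex =
  ∈-filterᵇ⁺ (expansionᵇ D S) (∈-vertices⁺ v∈[n]) (Equivalence.from T-∨ (bool ex))
  where
  bool : Expansion D S v → T (memᵇ v S) ⊎ T (any (λ u → adjacentᵇ D u v) S)
  bool (inj₁ v∈S)             = inj₁ (memᵇ⁺ v∈S)
  bool (inj₂ (u , u∈S , u~v)) = inj₂ (any⁺ _ (lose u∈S (adjacentᵇ⁺ u~v)))

iter-suc : ∀ (f : List ℕ → List ℕ) k S → iter (suc k) f S ≡ f (iter k f S)
iter-suc f zero    S = refl
iter-suc f (suc k) S = iter-suc f k (f S)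

ArcClosed : Diagram → (ℕ → Set) → Set
ArcClosed D P = ∀ {x y} → (x , y) ∈ D → P x ⇔ P y

module Reachability (n : ℕ) (D : Diagram) where

  Reachable : ℕ → ℕ → Set
  Reachable k v = v ∈ iter k (expand n D) (1 ∷ [])

  reachable-suc : ∀ k → IsVertex n v → Expansion D (iter k (expand n D) (1 ∷ [])) v →
                  Reachable (suc k) v
  reachable-suc k v∈[n] ex = subst (_ ∈_) (sym (iter-suc (expand n D) k _)) (∈-expand⁺ v∈[n] ex)

  reachable-adjacent : ∀ k → IsVertex n v → Reachable k u → Adjacent D u v → Reachable (suc k) v
  reachable-adjacent k v∈[n] u-reached u~v = reachable-suc k v∈[n] (inj₂ (_ , u-reached , u~v))

  reachable-mono : IsVertex n v → k ≤ m → Reachable k v → Reachable m v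
  reachable-mono {m = zero}  _     z≤n   r = r
  reachable-mono {m = suc m} v∈[n] k≤1+m r with m≤n⇒m<n∨m≡n k≤1+m
  ... | inj₂ refl       = r
  ... | inj₁ (s≤s k≤m) = reachable-suc m v∈[n] (inj₁ (reachable-mono v∈[n] k≤m r))

  iter-expand-closed : ∀ {P} → ArcClosed D P → ∀ k S → All P S → All P (iter k (expand n D) S)
  iter-expand-closed     closed zero    S PS = PS
  iter-expand-closed {P} closed (suc k) S PS =
    iter-expand-closed closed k (expand n D S) (All.tabulate (step ∘ ∈-expand⁻ {n = n} {D = D} {S = S}))
    where
    step : ∀ {v} → Expansion D S v → P v
    step (inj₁ v∈S)                    = All.lookup PS v∈S
    step (inj₂ (u , u∈S , inj₁ uv∈D)) = Equivalence.to (closed uv∈D) (All.lookup PS u∈S)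
    step (inj₂ (u , u∈S , inj₂ vu∈D)) = Equivalence.from (closed vu∈D) (All.lookup PS u∈S)

  reachable-closed : ∀ {P} → ArcClosed D P → P 1 → Reachable k v → P v
  reachable-closed {k = k} closed P1 r = All.lookup (iter-expand-closed closed k _ (P1 ∷ [])) r

  isConnected⁻ : T (isConnected n D) → IsVertex n v → Reachable n v
  isConnected⁻ conn v∈[n] =
    memᵇ⁻ (All.lookup (All.all⁺ (λ v → memᵇ v (reachFrom1 n D)) (vertices n) conn)
                      (∈-vertices⁺ v∈[n]))

  isConnected⁺ : (∀ {v} → IsVertex n v → Reachable n v) → T (isConnected n D)
  isConnected⁺ reach = All.all⁻ _ (All.tabulate (memᵇ⁺ ∘ reach ∘ ∈-vertices⁻))

Crossing : Arc → Arc → Set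
Crossing (i₁ , j₁) (i₂ , j₂) = i₁ < i₂ × i₂ < j₁ × j₁ < j₂

NonCrossing : Diagram → Set
NonCrossing D = ∀ {a b} → a ∈ D → b ∈ D → ¬ Crossing a b

crossᵇ⁺ : ∀ a b → Crossing a b → T (crossᵇ a b)
crossᵇ⁺ _ _ (i₁<i₂ , i₂<j₁ , j₁<j₂) =
  Equivalence.from T-∧ (<⇒<ᵇ i₁<i₂ , Equivalence.from T-∧ (<⇒<ᵇ i₂<j₁ , <⇒<ᵇ j₁<j₂))

crossᵇ⁻ : ∀ a b → T (crossᵇ a b) → Crossing a b
crossᵇ⁻ (i₁ , j₁) (i₂ , j₂) t with Equivalence.to T-∧ t
... | i₁<ᵇi₂ , t′ with Equivalence.to T-∧ t′
...   | i₂<ᵇj₁ , j₁<ᵇj₂ = <ᵇ⇒< i₁ i₂ i₁<ᵇi₂ , <ᵇ⇒< i₂ j₁ i₂<ᵇj₁ , <ᵇ⇒< j₁ j₂ j₁<ᵇj₂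

isStack⁻ : T (isStack D) → NonCrossing D
isStack⁻ {D} t {a} {b} a∈D b∈D cr =
  Equivalence.to T-not (All.lookup (All.all⁺ _ D (All.lookup (All.all⁺ _ D t) a∈D)) b∈D)
                       (crossᵇ⁺ a b cr)

isStack⁺ : NonCrossing D → T (isStack D)
isStack⁺ nc = All.all⁻ _ (All.tabulate λ {a} a∈D → All.all⁻ _ (All.tabulate λ {b} b∈D →
  Equivalence.from T-not (nc a∈D b∈D ∘ crossᵇ⁻ a b)))

ZigzagVertex : Diagram → ℕ → Set
ZigzagVertex D v = deg D v < 3 × ¬ (0 < ld D v × 0 < rd D v)

zigzagVertexᵇ : Diagram → ℕ → Bool
zigzagVertexᵇ D v = (deg D v <ᵇ 3) ∧ not (positive (ld D v) ∧ positive (rd D v))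

zigzagVertexᵇ⁻ : T (zigzagVertexᵇ D v) → ZigzagVertex D v
zigzagVertexᵇ⁻ {D} {v} t with Equivalence.to T-∧ t
... | deg<ᵇ3 , not-both =
  <ᵇ⇒< (deg D v) 3 deg<ᵇ3 ,
  λ (ld>0 , rd>0) → Equivalence.to T-not not-both (Equivalence.from T-∧ (<⇒<ᵇ ld>0 , <⇒<ᵇ rd>0))

zigzagVertexᵇ⁺ : ZigzagVertex D v → T (zigzagVertexᵇ D v)
zigzagVertexᵇ⁺ {D} {v} (deg<3 , not-both) =
  Equivalence.from T-∧ (<⇒<ᵇ deg<3 , Equivalence.from T-not λ both →
    let (ld>0 , rd>0) = Equivalence.to T-∧ both
    in not-both (<ᵇ⇒< 0 (ld D v) ld>0 , <ᵇ⇒< 0 (rd D v) rd>0))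

module _ {D : Diagram} {v : ℕ} (zigzag : ZigzagVertex D v) where

  private
    v≡ᵇv : T (v ≡ᵇ v)
    v≡ᵇv = ≡⇒≡ᵇ v v refl

  zigzagVertex⇒no-pass-through : ∀ {i j} → (i , v) ∈ D → (v , j) ∈ D → ⊥
  zigzagVertex⇒no-pass-through iv∈D vj∈D = proj₂ zigzag
    (count-≥ (λ a → proj₂ a ≡ᵇ v) ([] ∷ []) (λ { (here refl) → iv∈D }) (v≡ᵇv ∷ []) ,
     count-≥ (λ a → proj₁ a ≡ᵇ v) ([] ∷ []) (λ { (here refl) → vj∈D }) (v≡ᵇv ∷ []))

  zigzagVertex⇒left-saturated : ∀ {i₁ i₂ i} → (i₁ , v) ∈ D → (i₂ , v) ∈ D → i₁ ≢ i₂ →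
                                (i , v) ∈ D → i ≡ i₁ ⊎ i ≡ i₂
  zigzagVertex⇒left-saturated i₁v i₂v i₁≢i₂ iv = Sum.map (cong proj₁) (cong proj₁)
    (count<3⇒≡⊎≡ (λ a → proj₂ a ≡ᵇ v) (≡-dec _≟_ _≟_)
      (≤-<-trans (m≤m+n (ld D v) (rd D v)) (proj₁ zigzag)) i₁v i₂v iv v≡ᵇv v≡ᵇv v≡ᵇv (i₁≢i₂ ∘ cong proj₁))

  zigzagVertex⇒right-saturated : ∀ {j₁ j₂ j} → (v , j₁) ∈ D → (v , j₂) ∈ D → j₁ ≢ j₂ →
                                 (v , j) ∈ D → j ≡ j₁ ⊎ j ≡ j₂
  zigzagVertex⇒right-saturated vj₁ vj₂ j₁≢j₂ vj = Sum.map (cong proj₂) (cong proj₂)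
    (count<3⇒≡⊎≡ (λ a → proj₁ a ≡ᵇ v) (≡-dec _≟_ _≟_)
      (≤-<-trans (m≤n+m (rd D v) (ld D v)) (proj₁ zigzag)) vj₁ vj₂ vj v≡ᵇv v≡ᵇv v≡ᵇv (j₁≢j₂ ∘ cong proj₂))

ld≤2 : Unique D → ∀ {u w} → (∀ {x} → (x , v) ∈ D → x ≡ u ⊎ x ≡ w) → ld D v ≤ 2
ld≤2 {D} {v} uD {u} {w} candidates = count-≤2 (λ e → proj₂ e ≡ᵇ v) uD on-candidates
  where
  on-candidates : ∀ {e} → e ∈ D → T (proj₂ e ≡ᵇ v) → e ≡ (u , v) ⊎ e ≡ (w , v)
  on-candidates {x , v′} xv′ t with ≡ᵇ⇒≡ v′ v t
  ... | refl = Sum.map (cong (_, v)) (cong (_, v)) (candidates xv′)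

rd≤2 : Unique D → ∀ {u w} → (∀ {y} → (v , y) ∈ D → y ≡ u ⊎ y ≡ w) → rd D v ≤ 2
rd≤2 {D} {v} uD {u} {w} candidates = count-≤2 (λ e → proj₁ e ≡ᵇ v) uD on-candidates
  where
  on-candidates : ∀ {e} → e ∈ D → T (proj₁ e ≡ᵇ v) → e ≡ (v , u) ⊎ e ≡ (v , w)
  on-candidates {v′ , y} v′y t with ≡ᵇ⇒≡ v′ v t
  ... | refl = Sum.map (cong (v ,_)) (cong (v ,_)) (candidates v′y)

ld≡0⊎rd≡0 : (∀ {i j} → (i , v) ∈ D → (v , j) ∈ D → ⊥) → ld D v ≡ 0 ⊎ rd D v ≡ 0
ld≡0⊎rd≡0 {v} {D} no-pass-through with any? (λ e → proj₂ e ≟ v) D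
... | no ∄in   = inj₁ (count-≡0 (λ e → proj₂ e ≡ᵇ v) λ e∈D t → ∄in (lose e∈D (≡ᵇ⇒≡ _ v t)))
... | yes ∃in with find ∃in
...   | _ , iv , refl = inj₂ (count-≡0 (λ e → proj₁ e ≡ᵇ v) λ { {_ , _} vj t →
          no-pass-through iv (subst (λ u → (u , _) ∈ D) (≡ᵇ⇒≡ _ v t) vj) })

zigzagVertex-intro : ld D v ≤ 2 → rd D v ≤ 2 → ld D v ≡ 0 ⊎ rd D v ≡ 0 → ZigzagVertex D v
zigzagVertex-intro {D} {v} _ rd-bound (inj₁ ld≡0) =
  s≤s (subst (λ m → m + rd D v ≤ 2) (sym ld≡0) rd-bound) , λ (ld>0 , _) → <⇒≢ ld>0 (sym ld≡0)
zigzagVertex-intro {D} {v} ld-bound _ (inj₂ rd≡0) =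
  s≤s (subst (λ m → ld D v + m ≤ 2) (sym rd≡0) (subst (_≤ 2) (sym (+-identityʳ _)) ld-bound)) ,
  λ (_ , rd>0) → <⇒≢ rd>0 (sym rd≡0)

record ConnectedZigzagStack (n : ℕ) (D : Diagram) : Set₁ where
  field
    arc-bounds      : ∀ {e} → e ∈ D → IsArc n e
    noncrossing     : NonCrossing D
    no-pass-through : ∀ {i v j} → (i , v) ∈ D → (v , j) ∈ D → ⊥
    left-saturated  : ∀ {i₁ i₂ i v} → (i₁ , v) ∈ D → (i₂ , v) ∈ D → i₁ ≢ i₂ →
                      (i , v) ∈ D → i ≡ i₁ ⊎ i ≡ i₂
    right-saturated : ∀ {v j₁ j₂ j} → (v , j₁) ∈ D → (v , j₂) ∈ D → j₁ ≢ j₂ →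
                      (v , j) ∈ D → j ≡ j₁ ⊎ j ≡ j₂
    connected       : ∀ {P} → ArcClosed D P → P 1 → ∀ {v} → IsVertex n v → P v

start-vertex : IsArc n (i , j) → IsVertex n i
start-vertex (1≤i , i<j , j≤n) = 1≤i , ≤-trans (<⇒≤ i<j) j≤n

end-vertex : IsArc n (i , j) → IsVertex n j
end-vertex (1≤i , i<j , j≤n) = ≤-trans 1≤i (<⇒≤ i<j) , j≤n

T-∧⁻ : ∀ a b → T (a ∧ b) → T a × T b
T-∧⁻ a b = Equivalence.to (T-∧ {a} {b})

T-∧⁺ : ∀ a b → T a × T b → T (a ∧ b)
T-∧⁺ a b = Equivalence.from (T-∧ {a} {b})

connectedZigzagStack : D ∈ diagrams n → T (isConnected n D ∧ isZigzagStack n D) →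
                       ConnectedZigzagStack n D
connectedZigzagStack {D} {n} D∈ valid = record
  { arc-bounds      = arc-bounds
  ; noncrossing     = isStack⁻ stack
  ; no-pass-through = λ iv → zigzagVertex⇒no-pass-through (zigzag (end-vertex (arc-bounds iv))) iv
  ; left-saturated  = λ i₁v → zigzagVertex⇒left-saturated (zigzag (end-vertex (arc-bounds i₁v))) i₁v
  ; right-saturated = λ vj₁ → zigzagVertex⇒right-saturated (zigzag (start-vertex (arc-bounds vj₁))) vj₁
  ; connected       = λ closed P1 v∈[n] → reachable-closed {k = n} closed P1 (isConnected⁻ conn v∈[n])
  }
  where
  open Reachability n D
  arc-bounds : ∀ {e} → e ∈ D → IsArc n e
  arc-bounds e∈D = ∈-allArcs⁻ (∈-sublists⇒⊆ (allArcs n) D∈ e∈D)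
  conn = proj₁ (T-∧⁻ (isConnected n D) (isZigzagStack n D) valid)
  zigzag-stack = proj₂ (T-∧⁻ (isConnected n D) (isZigzagStack n D) valid)
  stack = proj₁ (T-∧⁻ (isStack D) (all (zigzagVertexᵇ D) (vertices n)) zigzag-stack)
  vertices-ok = proj₂ (T-∧⁻ (isStack D) (all (zigzagVertexᵇ D) (vertices n)) zigzag-stack)
  zigzag : IsVertex n v → ZigzagVertex D v
  zigzag {v} v∈[n] = zigzagVertexᵇ⁻ {D} {v}
    (All.lookup (All.all⁺ (zigzagVertexᵇ D) (vertices n) vertices-ok) (∈-vertices⁺ v∈[n]))

-- Spirals

-- The arcs on the antidiagonals t and t + 1. On [l, r] with t = l + r (resp. t + 1 = l + r) they
-- form the path l – r – (l+1) – (r−1) – ⋯ (resp. r – l – (r−1) – (l+1) – ⋯).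
SpiralArc : ℕ → ℕ → ℕ → Set
SpiralArc t x y = x + y ≡ t ⊎ x + y ≡ suc t

SpiralOn : Diagram → ℕ → ℕ → ℕ → Set
SpiralOn D t l r = ∀ {x y} → l ≤ x → x < y → y ≤ r → (x , y) ∈ D ⇔ SpiralArc t x y

private variable
  l r t : ℕ

spiralOn-vacuous : r ≤ l → SpiralOn D t l r
spiralOn-vacuous r≤l l≤x x<y y≤r = ⊥-elim (<⇒≱ (≤-<-trans l≤x x<y) (≤-trans y≤r r≤l))

spiralOn-∷ˡ : (∀ {y} → l < y → y ≤ r → (l , y) ∈ D ⇔ SpiralArc t l y) → SpiralOn D t (suc l) r →
              SpiralOn D t l r
spiralOn-∷ˡ column inner l≤x x<y y≤r with m≤n⇒m<n∨m≡n l≤x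
... | inj₁ l<x  = inner l<x x<y y≤r
... | inj₂ refl = column x<y y≤r

spiralOn-∷ʳ : (∀ {x} → l ≤ x → x < suc r → (x , suc r) ∈ D ⇔ SpiralArc t x (suc r)) →
              SpiralOn D t l r → SpiralOn D t l (suc r)
spiralOn-∷ʳ column inner l≤x x<y y≤r+1 with m≤n⇒m<n∨m≡n y≤r+1
... | inj₁ y<r+1 = inner l≤x x<y (≤-pred y<r+1)
... | inj₂ refl  = column l≤x x<y

spiralArc-start : t ≡ l + r → ∀ {y} → y ≤ r → SpiralArc t l y ⇔ y ≡ r
spiralArc-start {t} {l} {r} refl {y} y≤r = mk⇔ to λ { refl → inj₁ refl }
  where
  to : SpiralArc (l + r) l y → y ≡ r
  to (inj₁ l+y≡l+r)   = +-cancelˡ-≡ l y r l+y≡l+r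
  to (inj₂ l+y≡l+r+1) =
    ⊥-elim (<⇒≱ (s≤s y≤r) (≤-reflexive (+-cancelˡ-≡ l (suc r) y (trans (+-suc l r) (sym l+y≡l+r+1)))))

spiralArc-end : suc t ≡ l + r → ∀ {x} → l ≤ x → SpiralArc t x r ⇔ x ≡ l
spiralArc-end {t} {l} {r} t+1≡l+r {x} l≤x = mk⇔ to λ { refl → inj₂ (sym t+1≡l+r) }
  where
  to : SpiralArc t x r → x ≡ l
  to (inj₁ x+r≡t)   =
    ⊥-elim (<⇒≱ (+-cancelʳ-< r x l (subst (x + r <_) t+1≡l+r (≤-reflexive (cong suc x+r≡t)))) l≤x)
  to (inj₂ x+r≡t+1) = +-cancelʳ-≡ r x l (trans x+r≡t+1 t+1≡l+r)

spiralArc-nested : ∀ {i₁ j₁ i₂ j₂} → SpiralArc t i₁ j₁ → SpiralArc t i₂ j₂ → i₁ < i₂ → j₁ < j₂ → ⊥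
spiralArc-nested {t} {i₁} {j₁} {i₂} {j₂} arc₁ arc₂ i₁<i₂ j₁<j₂ = <⇒≱ (begin-strict
  suc t                ≤⟨ s≤s (lower {i₁} arc₁) ⟩
  suc (i₁ + j₁)        ≡⟨ +-suc i₁ j₁ ⟨
  i₁ + suc j₁          <⟨ +-mono-≤ i₁<i₂ j₁<j₂ ⟩
  i₂ + j₂              ∎) (upper {i₂} arc₂)
  where
  open ≤-Reasoning
  lower : ∀ {x y} → SpiralArc t x y → t ≤ x + y
  lower (inj₁ x+y≡t)   = ≤-reflexive (sym x+y≡t)
  lower (inj₂ x+y≡t+1) = ≤-trans (n≤1+n t) (≤-reflexive (sym x+y≡t+1))
  upper : ∀ {x y} → SpiralArc t x y → x + y ≤ suc t
  upper (inj₁ x+y≡t)   = ≤-trans (≤-reflexive x+y≡t) (n≤1+n t)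
  upper (inj₂ x+y≡t+1) = ≤-reflexive x+y≡t+1

spiralArc-start-cases : ∀ {x y} → SpiralArc t x y → x ≡ t ∸ y ⊎ x ≡ suc t ∸ y
spiralArc-start-cases {x = x} {y} = Sum.map solve solve
  where
  solve : ∀ {s} → x + y ≡ s → x ≡ s ∸ y
  solve x+y≡s = trans (sym (m+n∸n≡m x y)) (cong (_∸ y) x+y≡s)

spiralArc-end-cases : ∀ {x y} → SpiralArc t x y → y ≡ t ∸ x ⊎ y ≡ suc t ∸ x
spiralArc-end-cases {x = x} {y} = Sum.map solve solve
  where
  solve : ∀ {s} → x + y ≡ s → y ≡ s ∸ x
  solve x+y≡s = trans (sym (m+n∸m≡n x y)) (cong (_∸ x) x+y≡s)

-- The candidate with parameter a: spirals on [1, a] and on [a+1, n], joined by the arc (1 , n).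
ZigzagArc : ℕ → ℕ → Arc → Set
ZigzagArc n a (x , y) =
  (y ≤ a × SpiralArc (suc a) x y) ⊎ (a < x × SpiralArc (a + n) x y) ⊎ (x ≡ 1 × y ≡ n)

spiralArc? : ∀ t x y → Dec (SpiralArc t x y)
spiralArc? t x y = (x + y ≟ t) ⊎-dec (x + y ≟ suc t)

zigzagArc? : ∀ n a e → Dec (ZigzagArc n a e)
zigzagArc? n a (x , y) =
  ((y ≤? a) ×-dec spiralArc? (suc a) x y) ⊎-dec
  ((a <? x) ×-dec spiralArc? (a + n) x y) ⊎-dec
  ((x ≟ 1) ×-dec (y ≟ n))

zigzagDiagram : ℕ → ℕ → Diagram
zigzagDiagram n a = filter (zigzagArc? n a) (allArcs n)

-- Structure of a connected zigzag stack

ExitArc : ℕ → ℕ → Arc → Set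
ExitArc l r (x , y) = (l < x × x < r × r ≤ y) ⊎ (x ≤ l × l < y × y < r)

exitArc? : ∀ l r e → Dec (ExitArc l r e)
exitArc? l r (x , y) = (l <? x ×-dec x <? r ×-dec r ≤? y) ⊎-dec (x ≤? l ×-dec l <? y ×-dec y <? r)

module Shape {n : ℕ} {D : Diagram} (Z : ConnectedZigzagStack n D) where

  open ConnectedZigzagStack Z

  private variable
    a p : ℕ

  arc< : (x , y) ∈ D → x < y
  arc< xy = proj₁ (proj₂ (arc-bounds xy))

  start≥1 : (x , y) ∈ D → 1 ≤ x
  start≥1 xy = proj₁ (arc-bounds xy)

  end≤n : (x , y) ∈ D → y ≤ n
  end≤n xy = proj₂ (proj₂ (arc-bounds xy))

  crossing : ∀ {i₁ j₁ i₂ j₂} → (i₁ , j₁) ∈ D → (i₂ , j₂) ∈ D → i₁ < i₂ → i₂ < j₁ → j₁ < j₂ → ⊥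
  crossing a b i₁<i₂ i₂<j₁ j₁<j₂ = noncrossing a b (i₁<i₂ , i₂<j₁ , j₁<j₂)

  nested-end : ∀ {l r x y} → (l , r) ∈ D → (x , y) ∈ D → l < x → x < r → y ≤ r
  nested-end {r = r} {y = y} lr xy l<x x<r with y ≤? r
  ... | yes y≤r = y≤r
  ... | no  y≰r = ⊥-elim (crossing lr xy l<x x<r (≰⇒> y≰r))

  nested-start : ∀ {l r x y} → (l , r) ∈ D → (x , y) ∈ D → l < y → y < r → l ≤ x
  nested-start {l = l} {x = x} lr xy l<y y<r with l ≤? x
  ... | yes l≤x = l≤x
  ... | no  l≰x = ⊥-elim (crossing xy lr (≰⇒> l≰x) l<y y<r)

  escape : 1 ≤ l → suc l < r → r ≤ n → ∃[ e ] (e ∈ D × ExitArc l r e)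
  escape {l} {r} 1≤l l+1<r r≤n with any? (exitArc? l r) D
  ... | yes exit = find exit
  ... | no ∄exit =
    ⊥-elim (connected closed 1-outside (s≤s z≤n , ≤-trans (<⇒≤ l+1<r) r≤n) (≤-refl , l+1<r))
    where
    Outside : ℕ → Set
    Outside v = ¬ (l < v × v < r)
    1-outside : Outside 1
    1-outside (l<1 , _) = <⇒≱ l<1 1≤l
    closed : ArcClosed D Outside
    closed {x} {y} xy = mk⇔ forward backward
      where
      forward : Outside x → Outside y
      forward out (l<y , y<r) with x ≤? l
      ... | yes x≤l = ∄exit (lose xy (inj₂ (x≤l , l<y , y<r)))
      ... | no  x≰l = out (≰⇒> x≰l , <-trans (arc< xy) y<r)
      backward : Outside y → Outside x
      backward out (l<x , x<r) with r ≤? y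
      ... | yes r≤y = ∄exit (lose xy (inj₁ (l<x , x<r , r≤y)))
      ... | no  r≰y = out (<-trans l<x (arc< xy) , ≰⇒> r≰y)

  top-arc : 2 ≤ n → (1 , n) ∈ D
  top-arc 2≤n with connected closed (inj₁ refl) {n} (≤-trans (s≤s z≤n) 2≤n , ≤-refl)
    where
    Covered : ℕ → Set
    Covered v = v ≡ 1 ⊎ ∃[ j ] ((1 , j) ∈ D × v ≤ j)
    closed : ArcClosed D Covered
    closed {x} {y} xy = mk⇔ forward backward
      where
      forward : Covered x → Covered y
      forward (inj₁ refl) = inj₂ (y , xy , ≤-refl)
      forward (inj₂ (j , 1j , x≤j)) with y ≤? j | m≤n⇒m<n∨m≡n (start≥1 xy) | m≤n⇒m<n∨m≡n x≤j
      ... | yes y≤j | _         | _         = inj₂ (j , 1j , y≤j)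
      ... | no  _   | inj₂ refl | _         = inj₂ (y , xy , ≤-refl)
      ... | no  _   | inj₁ _    | inj₂ refl = ⊥-elim (no-pass-through 1j xy)
      ... | no  y≰j | inj₁ 1<x  | inj₁ x<j  = ⊥-elim (crossing 1j xy 1<x x<j (≰⇒> y≰j))
      backward : Covered y → Covered x
      backward (inj₁ refl)           = ⊥-elim (<⇒≱ (arc< xy) (start≥1 xy))
      backward (inj₂ (j , 1j , y≤j)) = inj₂ (j , 1j , ≤-trans (<⇒≤ (arc< xy)) y≤j)
  ... | inj₁ n≡1            = ⊥-elim (<⇒≢ 2≤n (sym n≡1))
  ... | inj₂ (j , 1j , n≤j) = subst (λ j → (1 , j) ∈ D) (≤-antisym (end≤n 1j) n≤j) 1j

  NoArcEnters : ℕ → ℕ → Set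
  NoArcEnters l r = ∀ {x y} → (x , y) ∈ D → x ≤ l → l < y → y < r → ⊥

  NoArcJumpsOver : ℕ → ℕ → Set
  NoArcJumpsOver l r = ∀ {x y} → (x , y) ∈ D → l < x → x < r → y ≤ r

  -- If l + 1 < c, the interval (l , c) is cut off: r already has its two arcs (p , r) and (c , r).
  opener-next : (p , r) ∈ D → p ≤ l → 1 ≤ l → NoArcEnters l r → NoArcJumpsOver l r →
                ∀ {c} → (c , r) ∈ D → l < c → c < r → c ≡ suc l
  opener-next {p} {r} {l} pr p≤l 1≤l no-entry no-jump {c} cr l<c c<r with m≤n⇒m<n∨m≡n l<c
  ... | inj₂ l+1≡c = sym l+1≡c
  ... | inj₁ l+1<c with escape 1≤l l+1<c (≤-trans (<⇒≤ c<r) (end≤n pr))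
  ...   | _ , xy , inj₂ (x≤l , l<y , y<c) = ⊥-elim (no-entry xy x≤l l<y (<-trans y<c c<r))
  ...   | (x , y) , xy , inj₁ (l<x , x<c , c≤y)
          with m≤n⇒m<n∨m≡n c≤y | m≤n⇒m<n∨m≡n (no-jump xy l<x (<-trans x<c c<r))
  ...     | inj₂ refl | _         = ⊥-elim (no-pass-through xy cr)
  ...     | inj₁ c<y  | inj₁ y<r  = ⊥-elim (crossing xy cr x<c c<y y<r)
  ...     | inj₁ _    | inj₂ refl with left-saturated pr cr (<⇒≢ (≤-<-trans p≤l l<c)) xy
  ...       | inj₁ refl = ⊥-elim (<⇒≱ l<x p≤l)
  ...       | inj₂ refl = ⊥-elim (<-irrefl refl x<c)

  opener-step : (p , r) ∈ D → p ≤ l → 1 ≤ l → suc l < r → NoArcEnters l r → NoArcJumpsOver l r →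
                (suc l , r) ∈ D
  opener-step pr p≤l 1≤l l+1<r no-entry no-jump with escape 1≤l l+1<r (end≤n pr)
  ... | _ , xy , inj₂ (x≤l , l<y , y<r) = ⊥-elim (no-entry xy x≤l l<y y<r)
  ... | (c , y) , cy , inj₁ (l<c , c<r , r≤y) with ≤-antisym (no-jump cy l<c c<r) r≤y
  ...   | refl = subst (λ c → (c , y) ∈ D) (opener-next pr p≤l 1≤l no-entry no-jump cy l<c c<r) cy

  closer-next : (l , suc r) ∈ D → (∀ {x} → (x , suc r) ∈ D → x ≤ l) →
                ∀ {c} → (l , c) ∈ D → l < c → c ≤ r → c ≡ r
  closer-next {l} {r} lr closer {c} lc l<c c≤r with m≤n⇒m<n∨m≡n c≤r
  ... | inj₂ c≡r = c≡r
  ... | inj₁ c<r with escape (≤-trans (start≥1 lr) (<⇒≤ l<c)) (s≤s c<r) (end≤n lr)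
  ...   | (x , y) , xy , inj₁ (c<x , x<r+1 , r+1≤y) =
    ⊥-elim (<⇒≱ (<-trans l<c c<x) (closer (subst (λ y → (x , y) ∈ D) y≡r+1 xy)))
    where y≡r+1 = ≤-antisym (nested-end lr xy (<-trans l<c c<x) x<r+1) r+1≤y
  ...   | (x , y) , xy , inj₂ (x≤c , c<y , y<r+1)
          with m≤n⇒m<n∨m≡n (nested-start lr xy (<-trans l<c c<y) y<r+1) | m≤n⇒m<n∨m≡n x≤c
  ...     | inj₁ l<x  | inj₁ x<c  = ⊥-elim (crossing lc xy l<x x<c c<y)
  ...     | inj₁ _    | inj₂ refl = ⊥-elim (no-pass-through lc xy)
  ...     | inj₂ refl | _         with right-saturated lr lc (≢-sym (<⇒≢ (s≤s c≤r))) xy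
  ...       | inj₁ refl = ⊥-elim (<-irrefl refl y<r+1)
  ...       | inj₂ refl = ⊥-elim (<-irrefl refl c<y)

  closer-step : (l , suc r) ∈ D → (∀ {x} → (x , suc r) ∈ D → x ≤ l) → l < r → (l , r) ∈ D
  closer-step lr closer l<r with escape (start≥1 lr) (s≤s l<r) (end≤n lr)
  ... | (x , y) , xy , inj₁ (l<x , x<r+1 , r+1≤y) =
    ⊥-elim (<⇒≱ l<x (closer (subst (λ y → (x , y) ∈ D) y≡r+1 xy)))
    where y≡r+1 = ≤-antisym (nested-end lr xy l<x x<r+1) r+1≤y
  ... | (x , c) , xc , inj₂ (x≤l , l<c , c<r+1) with ≤-antisym x≤l (nested-start lr xc l<c c<r+1)
  ...   | refl = subst (λ c → (x , c) ∈ D) (closer-next lr closer xc l<c (≤-pred c<r+1)) xc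

  opener-column : t ≡ l + r → (l , r) ∈ D → (∀ {y} → (l , y) ∈ D → r ≤ y) →
                  ∀ {y} → l < y → y ≤ r → (l , y) ∈ D ⇔ SpiralArc t l y
  opener-column {l = l} t≡l+r lr opener _ y≤r = mk⇔
    (λ ly → Equivalence.from (spiralArc-start t≡l+r y≤r) (≤-antisym y≤r (opener ly)))
    (λ arc → subst (λ y → (l , y) ∈ D) (sym (Equivalence.to (spiralArc-start t≡l+r y≤r) arc)) lr)

  closer-column : suc t ≡ l + r → (l , r) ∈ D → (∀ {x} → (x , r) ∈ D → x ≤ l) →
                  ∀ {x} → l ≤ x → x < r → (x , r) ∈ D ⇔ SpiralArc t x r
  closer-column {r = r} t+1≡l+r lr closer l≤x _ = mk⇔
    (λ xr → Equivalence.from (spiralArc-end t+1≡l+r l≤x) (≤-antisym (closer xr) l≤x))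
    (λ arc → subst (λ x → (x , r) ∈ D) (sym (Equivalence.to (spiralArc-end t+1≡l+r l≤x) arc)) lr)

  opener-no-entry : (l , r) ∈ D → (∀ {y} → (l , y) ∈ D → r ≤ y) → NoArcEnters l r
  opener-no-entry lr opener xy x≤l l<y y<r with m≤n⇒m<n∨m≡n x≤l
  ... | inj₁ x<l  = crossing xy lr x<l l<y y<r
  ... | inj₂ refl = <⇒≱ y<r (opener xy)

  -- The gap k bounds the recursion: each step moves one end of the arc (l , r) inwards.
  spiral-opener : ∀ k {l r t} → suc l + k ≡ r → t ≡ l + r → (l , r) ∈ D →
                  (∀ {y} → (l , y) ∈ D → r ≤ y) → SpiralOn D t l r
  spiral-closer : ∀ k {l r t} → suc l + k ≡ r → suc t ≡ l + r → (l , r) ∈ D →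
                  (∀ {x} → (x , r) ∈ D → x ≤ l) → SpiralOn D t l r

  spiral-opener zero {l} refl t≡l+r lr opener =
    spiralOn-∷ˡ (opener-column t≡l+r lr opener)
      (spiralOn-vacuous (≤-reflexive (cong suc (+-identityʳ l))))
  spiral-opener (suc k) {l} {r} gap t≡l+r lr opener =
    spiralOn-∷ˡ (opener-column t≡l+r lr opener)
      (spiral-closer k (trans (sym (+-suc (suc l) k)) gap) (cong suc t≡l+r) next closer)
    where
    next : (suc l , r) ∈ D
    next = opener-step lr ≤-refl (start≥1 lr) (subst (suc l <_) gap (m<m+n (suc l) z<s))
             (opener-no-entry lr opener) (nested-end lr)
    closer : ∀ {x} → (x , r) ∈ D → x ≤ suc l
    closer xr with left-saturated lr next (<⇒≢ ≤-refl) xr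
    ... | inj₁ refl = n≤1+n l
    ... | inj₂ refl = ≤-refl

  spiral-closer zero {l} refl t+1≡l+r lr closer =
    spiralOn-∷ʳ (closer-column t+1≡l+r lr closer) (spiralOn-vacuous (≤-reflexive (+-identityʳ l)))
  spiral-closer (suc k) {l} {t = t} refl t+1≡l+r lr closer =
    spiralOn-∷ʳ (closer-column t+1≡l+r lr closer)
      (spiral-opener k (sym (+-suc l k)) t≡l+r′ next opener)
    where
    t≡l+r′ : t ≡ l + (l + suc k)
    t≡l+r′ = suc-injective (trans t+1≡l+r (+-suc l (l + suc k)))
    next : (l , l + suc k) ∈ D
    next = closer-step lr closer (m<m+n l z<s)
    opener : ∀ {y} → (l , y) ∈ D → l + suc k ≤ y
    opener ly with right-saturated lr next (≢-sym (<⇒≢ ≤-refl)) ly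
    ... | inj₁ refl = n≤1+n (l + suc k)
    ... | inj₂ refl = ≤-refl

  spiralOn-opener : (l , r) ∈ D → (∀ {y} → (l , y) ∈ D → r ≤ y) → SpiralOn D (l + r) l r
  spiralOn-opener lr opener with m≤n⇒∃[o]m+o≡n (arc< lr)
  ... | k , gap = spiral-opener k gap refl lr opener

  spiralOn-closer : (l , r) ∈ D → (∀ {x} → (x , r) ∈ D → x ≤ l) → suc t ≡ l + r → SpiralOn D t l r
  spiralOn-closer lr closer t+1≡l+r with m≤n⇒∃[o]m+o≡n (arc< lr)
  ... | k , gap = spiral-closer k gap t+1≡l+r lr closer

  Bridge : ℕ → Set
  Bridge a = ∀ {x y} → (x , y) ∈ D → x ≤ a → a < y → x ≡ 1 × y ≡ n

  -- a is the other neighbour of vertex 1, or 1 itself if (1 , n) is the only arc at 1.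
  left-part : 2 ≤ n → ∃[ a ] (1 ≤ a × a < n × SpiralOn D (suc a) 1 a × Bridge a)
  left-part 2≤n with any? (λ (x , y) → (x ≟ 1) ×-dec (y <? n)) D
  ... | no ∄short = 1 , ≤-refl , 2≤n , spiralOn-vacuous ≤-refl , bridge
    where
    bridge : Bridge 1
    bridge {x} {y} xy x≤1 _ with ≤-antisym x≤1 (start≥1 xy) | m≤n⇒m<n∨m≡n (end≤n xy)
    ... | refl | inj₁ y<n = ⊥-elim (∄short (lose xy (refl , y<n)))
    ... | refl | inj₂ y≡n = refl , y≡n
  ... | yes ∃short with find ∃short
  ...   | (_ , a) , 1a , (refl , a<n) = a , <⇒≤ (arc< 1a) , a<n , left , bridge
    where
    top = top-arc 2≤n
    arcs-of-1 : ∀ {y} → (1 , y) ∈ D → y ≡ a ⊎ y ≡ n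
    arcs-of-1 = right-saturated 1a top (<⇒≢ a<n)
    left : SpiralOn D (suc a) 1 a
    left = spiralOn-opener 1a λ 1y → Sum.[ ≤-reflexive ∘ sym , (λ { refl → <⇒≤ a<n }) ] (arcs-of-1 1y)
    bridge : Bridge a
    bridge {x} {y} xy x≤a a<y with m≤n⇒m<n∨m≡n (start≥1 xy) | m≤n⇒m<n∨m≡n x≤a
    ... | inj₂ refl | _         =
      Sum.[ (λ { refl → ⊥-elim (<-irrefl refl a<y) }) , (refl ,_) ] (arcs-of-1 xy)
    ... | inj₁ 1<x  | inj₁ x<a  = ⊥-elim (crossing 1a xy 1<x x<a a<y)
    ... | inj₁ _    | inj₂ refl = ⊥-elim (no-pass-through 1a xy)

  right-part : 1 ≤ a → a < n → Bridge a → SpiralOn D (a + n) (suc a) n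
  right-part {a} 1≤a a<n bridge with m≤n⇒m<n∨m≡n a<n
  ... | inj₂ refl   = spiralOn-vacuous ≤-refl
  ... | inj₁ a+1<n = spiralOn-closer next closer refl
    where
    top = top-arc (≤-trans (s≤s 1≤a) a<n)
    next : (suc a , n) ∈ D
    next = opener-step top 1≤a 1≤a a+1<n (λ xy x≤a a<y y<n → <⇒≢ y<n (proj₂ (bridge xy x≤a a<y)))
             (λ xy _ _ → end≤n xy)
    closer : ∀ {x} → (x , n) ∈ D → x ≤ suc a
    closer xn with left-saturated top next (<⇒≢ (s≤s 1≤a)) xn
    ... | inj₁ refl = s≤s z≤n
    ... | inj₂ refl = ≤-refl

  shape : 2 ≤ n →
          ∃[ a ] (1 ≤ a × a < n × ∀ {x y} → IsArc n (x , y) → (x , y) ∈ D ⇔ ZigzagArc n a (x , y))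
  shape 2≤n with left-part 2≤n
  ... | a , 1≤a , a<n , left , bridge = a , 1≤a , a<n , λ arc → mk⇔ (to arc) (from arc)
    where
    right = right-part 1≤a a<n bridge
    to : ∀ {x y} → IsArc n (x , y) → (x , y) ∈ D → ZigzagArc n a (x , y)
    to {x} {y} (1≤x , x<y , y≤n) xy with y ≤? a | x ≤? a
    ... | yes y≤a | _       = inj₁ (y≤a , Equivalence.to (left 1≤x x<y y≤a) xy)
    ... | no  y≰a | yes x≤a = inj₂ (inj₂ (bridge xy x≤a (≰⇒> y≰a)))
    ... | no  _   | no  x≰a = inj₂ (inj₁ (≰⇒> x≰a , Equivalence.to (right (≰⇒> x≰a) x<y y≤n) xy))
    from : ∀ {x y} → IsArc n (x , y) → ZigzagArc n a (x , y) → (x , y) ∈ D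
    from (1≤x , x<y , _)   (inj₁ (y≤a , arc))        = Equivalence.from (left 1≤x x<y y≤a) arc
    from (_   , x<y , y≤n) (inj₂ (inj₁ (a<x , arc))) = Equivalence.from (right a<x x<y y≤n) arc
    from _                 (inj₂ (inj₂ (refl , refl))) = top-arc 2≤n

-- The candidates are connected zigzag stacks

HasSpiral : Diagram → ℕ → ℕ → ℕ → Set
HasSpiral D t l r = ∀ {x y} → l ≤ x → x < y → y ≤ r → SpiralArc t x y → (x , y) ∈ D

module SpiralReachability (n : ℕ) (D : Diagram) where

  open Reachability n D

  reach-opener : ∀ g {l r t k} → l + g ≡ r → t ≡ l + r → 1 ≤ l → r ≤ n → HasSpiral D t l r →
                 Reachable k l → ∀ {v} → l ≤ v → v ≤ r → Reachable (k + g) v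
  reach-closer : ∀ g {l r t k} → l + g ≡ r → suc t ≡ l + r → 1 ≤ l → r ≤ n → HasSpiral D t l r →
                 Reachable k r → ∀ {v} → l ≤ v → v ≤ r → Reachable (k + g) v

  reach-opener zero {l} {k = k} refl _ _ _ _ reached l≤v v≤l+0
    with refl ← ≤-antisym (≤-trans v≤l+0 (≤-reflexive (+-identityʳ l))) l≤v =
    subst (λ m → Reachable m l) (sym (+-identityʳ k)) reached
  reach-opener (suc g) {l} {r} {t} {k} gap t≡l+r 1≤l r≤n spiral reached {v} l≤v v≤r
    with m≤n⇒m<n∨m≡n l≤v
  ... | inj₂ refl = reachable-mono (1≤l , ≤-trans v≤r r≤n) (m≤m+n k (suc g)) reached
  ... | inj₁ l<v  = subst (λ m → Reachable m v) (sym (+-suc k g))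
        (reach-closer g {k = suc k} (trans (sym (+-suc l g)) gap) (cong suc t≡l+r) (s≤s z≤n) r≤n
          (λ l<x → spiral (<⇒≤ l<x)) reached-r l<v v≤r)
    where
    l<r : l < r
    l<r = subst (l <_) gap (m<m+n l z<s)
    reached-r : Reachable (suc k) r
    reached-r = reachable-adjacent k (≤-trans 1≤l (<⇒≤ l<r) , r≤n) reached
                  (inj₁ (spiral ≤-refl l<r ≤-refl (inj₁ (sym t≡l+r))))

  reach-closer zero {l} {k = k} refl _ _ _ _ reached l≤v v≤l+0
    with refl ← ≤-antisym v≤l+0 (≤-trans (≤-reflexive (+-identityʳ l)) l≤v) =
    subst (λ m → Reachable m (l + 0)) (sym (+-identityʳ k)) reached
  reach-closer (suc g) {l} {t = t} {k} refl t+1≡l+r 1≤l r≤n spiral reached {v} l≤v v≤r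
    with m≤n⇒m<n∨m≡n v≤r
  ... | inj₂ refl = reachable-mono (≤-trans 1≤l l≤v , r≤n) (m≤m+n k (suc g)) reached
  ... | inj₁ v<r  = subst (λ m → Reachable m v) (sym (+-suc k g))
        (reach-opener g {k = suc k} refl t≡l+r′ 1≤l (≤-trans r′≤r r≤n)
          (λ l≤x x<y y≤r′ → spiral l≤x x<y (≤-trans y≤r′ r′≤r)) reached-l l≤v
          (≤-pred (subst (v <_) (+-suc l g) v<r)))
    where
    r′≤r : l + g ≤ l + suc g
    r′≤r = +-monoʳ-≤ l (n≤1+n g)
    t≡l+r′ : t ≡ l + (l + g)
    t≡l+r′ = suc-injective (trans t+1≡l+r (trans (cong (l +_) (+-suc l g)) (+-suc l (l + g))))
    reached-l : Reachable (suc k) l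
    reached-l = reachable-adjacent k (1≤l , ≤-trans (m≤m+n l (suc g)) r≤n) reached
                  (inj₂ (spiral ≤-refl (m<m+n l z<s) ≤-refl (inj₂ (sym t+1≡l+r))))

module ZigzagDiagram {n a : ℕ} (1≤a : 1 ≤ a) (a<n : a < n) where

  E = zigzagDiagram n a

  ∈E⁻ : ∀ {e} → e ∈ E → IsArc n e × ZigzagArc n a e
  ∈E⁻ e∈E with ∈-filter⁻ (zigzagArc? n a) {xs = allArcs n} e∈E
  ... | e∈arcs , zigzag = ∈-allArcs⁻ e∈arcs , zigzag

  ∈E⁺ : ∀ {x y} → IsArc n (x , y) → ZigzagArc n a (x , y) → (x , y) ∈ E
  ∈E⁺ arc zigzag = ∈-filter⁺ (zigzagArc? n a) (∈-allArcs⁺ arc) zigzag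

  unique : Unique E
  unique = Unique.filter⁺ (zigzagArc? n a) (allArcs-unique n)

  noncrossing : NonCrossing E
  noncrossing {i₁ , j₁} {i₂ , j₂} e₁ e₂ (i₁<i₂ , i₂<j₁ , j₁<j₂) with ∈E⁻ e₁ | ∈E⁻ e₂
  ... | (1≤i₁ , _) , _             | _ , inj₂ (inj₂ (refl , _)) = <⇒≱ i₁<i₂ 1≤i₁
  ... | _ , inj₂ (inj₂ (_ , refl)) | (_ , _ , j₂≤n) , _         = <⇒≱ j₁<j₂ j₂≤n
  ... | _ , inj₁ (_ , arc₁)        | _ , inj₁ (_ , arc₂)        =
    spiralArc-nested arc₁ arc₂ i₁<i₂ j₁<j₂
  ... | _ , inj₂ (inj₁ (_ , arc₁)) | _ , inj₂ (inj₁ (_ , arc₂)) =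
    spiralArc-nested arc₁ arc₂ i₁<i₂ j₁<j₂
  ... | _ , inj₁ (j₁≤a , _)        | _ , inj₂ (inj₁ (a<i₂ , _)) = <⇒≱ (<-trans a<i₂ i₂<j₁) j₁≤a
  ... | _ , inj₂ (inj₁ (a<i₁ , _)) | _ , inj₁ (j₂≤a , _)        =
    <⇒≱ (<-trans a<i₁ (<-trans i₁<i₂ (<-trans i₂<j₁ j₁<j₂))) j₂≤a

  no-pass-through : ∀ {x v y} → (x , v) ∈ E → (v , y) ∈ E → ⊥
  no-pass-through xv vy with ∈E⁻ xv | ∈E⁻ vy
  ... | _ , inj₂ (inj₂ (_ , refl)) | (_ , v<y , y≤n) , _        = <⇒≱ v<y y≤n
  ... | (1≤x , x<v , _) , _        | _ , inj₂ (inj₂ (refl , _)) = <⇒≱ x<v 1≤x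
  ... | (_ , x<v , _) , inj₁ (_ , arc₁) | (_ , v<y , _) , inj₁ (_ , arc₂) =
    spiralArc-nested arc₁ arc₂ x<v v<y
  ... | (_ , x<v , _) , inj₂ (inj₁ (_ , arc₁)) | (_ , v<y , _) , inj₂ (inj₁ (_ , arc₂)) =
    spiralArc-nested arc₁ arc₂ x<v v<y
  ... | _ , inj₁ (v≤a , _)         | _ , inj₂ (inj₁ (a<v , _))  = <⇒≱ a<v v≤a
  ... | (_ , x<v , _) , inj₂ (inj₁ (a<x , _)) | (_ , v<y , _) , inj₁ (y≤a , _) =
    <⇒≱ (<-trans a<x (<-trans x<v v<y)) y≤a

  two-left-neighbours : ∀ v → ∃₂ λ u w → ∀ {x} → (x , v) ∈ E → x ≡ u ⊎ x ≡ w
  two-left-neighbours v with v ≤? a | v ≟ n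
  ... | yes v≤a | _        = _ , _ , classify ∘ ∈E⁻
    where
    classify : ∀ {x} → IsArc n (x , v) × ZigzagArc n a (x , v) →
               x ≡ suc a ∸ v ⊎ x ≡ suc (suc a) ∸ v
    classify (_ , inj₁ (_ , arc))                     = spiralArc-start-cases arc
    classify ((_ , x<v , _) , inj₂ (inj₁ (a<x , _))) = ⊥-elim (<⇒≱ (<-trans a<x x<v) v≤a)
    classify (_ , inj₂ (inj₂ (_ , refl)))             = ⊥-elim (<⇒≱ a<n v≤a)
  ... | no v≰a  | no v≢n   = _ , _ , classify ∘ ∈E⁻
    where
    classify : ∀ {x} → IsArc n (x , v) × ZigzagArc n a (x , v) →
               x ≡ (a + n) ∸ v ⊎ x ≡ suc (a + n) ∸ v
    classify (_ , inj₁ (v≤a , _))        = ⊥-elim (v≰a v≤a)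
    classify (_ , inj₂ (inj₁ (_ , arc))) = spiralArc-start-cases arc
    classify (_ , inj₂ (inj₂ (_ , v≡n))) = ⊥-elim (v≢n v≡n)
  ... | no n≰a  | yes refl = 1 , suc a , classify ∘ ∈E⁻
    where
    classify : ∀ {x} → IsArc n (x , n) × ZigzagArc n a (x , n) → x ≡ 1 ⊎ x ≡ suc a
    classify (_ , inj₁ (n≤a , _))          = ⊥-elim (n≰a n≤a)
    classify (_ , inj₂ (inj₁ (a<x , arc))) = inj₂ (Equivalence.to (spiralArc-end refl a<x) arc)
    classify (_ , inj₂ (inj₂ (x≡1 , _)))   = inj₁ x≡1

  two-right-neighbours : ∀ v → ∃₂ λ u w → ∀ {y} → (v , y) ∈ E → y ≡ u ⊎ y ≡ w
  two-right-neighbours v with a <? v | v ≟ 1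
  ... | yes a<v | _        = _ , _ , classify ∘ ∈E⁻
    where
    classify : ∀ {y} → IsArc n (v , y) × ZigzagArc n a (v , y) →
               y ≡ (a + n) ∸ v ⊎ y ≡ suc (a + n) ∸ v
    classify ((_ , v<y , _) , inj₁ (y≤a , _)) = ⊥-elim (<⇒≱ (<-trans a<v v<y) y≤a)
    classify (_ , inj₂ (inj₁ (_ , arc)))      = spiralArc-end-cases arc
    classify (_ , inj₂ (inj₂ (refl , _)))     = ⊥-elim (<⇒≱ a<v 1≤a)
  ... | no a≮v  | no v≢1   = _ , _ , classify ∘ ∈E⁻
    where
    classify : ∀ {y} → IsArc n (v , y) × ZigzagArc n a (v , y) →
               y ≡ suc a ∸ v ⊎ y ≡ suc (suc a) ∸ v
    classify (_ , inj₁ (_ , arc))        = spiralArc-end-cases arc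
    classify (_ , inj₂ (inj₁ (a<v , _))) = ⊥-elim (a≮v a<v)
    classify (_ , inj₂ (inj₂ (v≡1 , _))) = ⊥-elim (v≢1 v≡1)
  ... | no a≮1  | yes refl = a , n , classify ∘ ∈E⁻
    where
    classify : ∀ {y} → IsArc n (1 , y) × ZigzagArc n a (1 , y) → y ≡ a ⊎ y ≡ n
    classify (_ , inj₁ (y≤a , arc))      = inj₁ (Equivalence.to (spiralArc-start refl y≤a) arc)
    classify (_ , inj₂ (inj₁ (a<1 , _))) = ⊥-elim (a≮1 a<1)
    classify (_ , inj₂ (inj₂ (_ , y≡n))) = inj₂ y≡n

  connected : T (isConnected n E)
  connected = isConnected⁺ reach
    where
    open Reachability n E
    open SpiralReachability n E
    left-spiral : HasSpiral E (suc a) 1 a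
    left-spiral 1≤x x<y y≤a arc = ∈E⁺ (1≤x , x<y , ≤-trans y≤a (<⇒≤ a<n)) (inj₁ (y≤a , arc))
    right-spiral : HasSpiral E (a + n) (suc a) n
    right-spiral a<x x<y y≤n arc = ∈E⁺ (≤-trans (s≤s z≤n) a<x , x<y , y≤n) (inj₂ (inj₁ (a<x , arc)))
    n-reached : Reachable 1 n
    n-reached = reachable-adjacent 0 (≤-trans (s≤s z≤n) a<n , ≤-refl) (here refl)
      (inj₁ (∈E⁺ (≤-refl , ≤-trans (s≤s 1≤a) a<n , ≤-refl) (inj₂ (inj₂ (refl , refl)))))
    reach : ∀ {v} → IsVertex n v → Reachable n v
    reach {v} v∈[n] with v ≤? a | m≤n⇒∃[o]m+o≡n 1≤a | m≤n⇒∃[o]m+o≡n a<n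
    ... | yes v≤a | g , 1+g≡a | _ =
      reachable-mono v∈[n] (≤-trans (n≤1+n g) (≤-trans (≤-reflexive 1+g≡a) (<⇒≤ a<n)))
        (reach-opener g {k = 0} 1+g≡a refl ≤-refl (<⇒≤ a<n) left-spiral (here refl)
          (proj₁ v∈[n]) v≤a)
    ... | no v≰a  | _ | g , a+1+g≡n =
      reachable-mono v∈[n] (≤-trans (s≤s (m≤n+m g a)) (≤-reflexive a+1+g≡n))
        (reach-closer g {k = 1} a+1+g≡n refl (s≤s z≤n) ≤-refl right-spiral n-reached
          (≰⇒> v≰a) (proj₂ v∈[n]))

  zigzag-stack : T (isZigzagStack n E)
  zigzag-stack = T-∧⁺ (isStack E) (all (zigzagVertexᵇ E) (vertices n))
    (isStack⁺ noncrossing , All.all⁻ (zigzagVertexᵇ E) {xs = vertices n}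
                              (All.tabulate λ {v} _ → zigzagVertexᵇ⁺ {E} {v} (vertex v)))
    where
    vertex : ∀ v → ZigzagVertex E v
    vertex v with two-left-neighbours v | two-right-neighbours v
    ... | _ , _ , left | _ , _ , right =
      zigzagVertex-intro {E} {v} (ld≤2 unique left) (rd≤2 unique right) (ld≡0⊎rd≡0 no-pass-through)

  valid : T (isConnected n E ∧ isZigzagStack n E)
  valid = T-∧⁺ (isConnected n E) (isZigzagStack n E) (connected , zigzag-stack)

connectedZigzagStack⇒zigzagDiagram : 2 ≤ n → D ∈ diagrams n → T (isConnected n D ∧ isZigzagStack n D) →
                                     ∃[ a ] (1 ≤ a × a < n × D ≡ zigzagDiagram n a)
connectedZigzagStack⇒zigzagDiagram {n} {D} 2≤n D∈ valid
  with Shape.shape (connectedZigzagStack D∈ valid) 2≤n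
... | a , 1≤a , a<n , shape = a , 1≤a , a<n ,
  sublists-ext (allArcs-unique n) D∈ (filter∈sublists (zigzagArc? n a) (allArcs n)) D⊆E E⊆D
  where
  open ZigzagDiagram 1≤a a<n using (∈E⁻; ∈E⁺)
  D⊆E : D ⊆ zigzagDiagram n a
  D⊆E {x , y} xy = ∈E⁺ arc (Equivalence.to (shape arc) xy)
    where arc = ∈-allArcs⁻ (∈-sublists⇒⊆ (allArcs n) D∈ xy)
  E⊆D : zigzagDiagram n a ⊆ D
  E⊆D {x , y} xy with ∈E⁻ xy
  ... | arc , zigzag = Equivalence.from (shape arc) zigzag

zigzagDiagram-injective : ∀ {n a b} → 1 ≤ a → a < b → b < n → zigzagDiagram n a ≢ zigzagDiagram n b
zigzagDiagram-injective {n} {a} {b} 1≤a a<b b<n Eₐ≡E_b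
  with ZigzagDiagram.∈E⁻ (<-trans 1≤a a<b) b<n (subst ((suc a , n) ∈_) Eₐ≡E_b a+1,n∈Eₐ)
  where
  a+1,n∈Eₐ : (suc a , n) ∈ zigzagDiagram n a
  a+1,n∈Eₐ = ZigzagDiagram.∈E⁺ 1≤a (<-trans a<b b<n) (s≤s z≤n , ≤-<-trans a<b b<n , ≤-refl)
               (inj₂ (inj₁ (≤-refl , inj₂ refl)))
... | _ , inj₁ (n≤b , _)          = <⇒≱ b<n n≤b
... | _ , inj₂ (inj₁ (b<a+1 , _)) = <⇒≱ a<b (≤-pred b<a+1)
... | _ , inj₂ (inj₂ (a+1≡1 , _)) = <⇒≢ 1≤a (sym (suc-injective a+1≡1))

zigzagDiagrams : ℕ → List Diagram
zigzagDiagrams m = applyUpTo (zigzagDiagram (suc m) ∘ suc) m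

zigzagDiagrams-unique : ∀ m → Unique (zigzagDiagrams m)
zigzagDiagrams-unique m = AllPairs.applyUpTo⁺₁ _ m λ i<j j<m →
  zigzagDiagram-injective (s≤s z≤n) (s≤s i<j) (s≤s j<m)

connectedZigzagStacks : ℕ → List Diagram
connectedZigzagStacks n = filterᵇ (λ D → isConnected n D ∧ isZigzagStack n D) (diagrams n)

connectedZigzagStacks-unique : ∀ n → Unique (connectedZigzagStacks n)
connectedZigzagStacks-unique n = Unique.filter⁺ _ (sublists-unique (allArcs-unique n))

connectedZigzagStacks⊆zigzagDiagrams : ∀ m → 1 ≤ m → connectedZigzagStacks (suc m) ⊆ zigzagDiagrams m
connectedZigzagStacks⊆zigzagDiagrams m 1≤m D∈ with ∈-filterᵇ⁻ _ (diagrams (suc m)) D∈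
... | D∈diagrams , valid with connectedZigzagStack⇒zigzagDiagram (s≤s 1≤m) D∈diagrams valid
...   | suc a , _ , a+1<n , refl = ∈-applyUpTo⁺ _ (≤-pred a+1<n)

zigzagDiagrams⊆connectedZigzagStacks : ∀ m → zigzagDiagrams m ⊆ connectedZigzagStacks (suc m)
zigzagDiagrams⊆connectedZigzagStacks m D∈ with ∈-applyUpTo⁻ _ D∈
... | a , a<m , refl =
  ∈-filterᵇ⁺ _ (filter∈sublists _ (allArcs (suc m))) (ZigzagDiagram.valid (s≤s z≤n) (s≤s a<m))

mainTheorem3 : (n : ℕ) → 2 ≤ n → c n ≡ n ∸ 1
mainTheorem3 (suc m) (s≤s 1≤m) = begin
  length (connectedZigzagStacks (suc m))
    ≡⟨ unique-⊆⊇⇒length≡ (connectedZigzagStacks-unique (suc m)) (zigzagDiagrams-unique m)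
         (connectedZigzagStacks⊆zigzagDiagrams m 1≤m) (zigzagDiagrams⊆connectedZigzagStacks m) ⟩
  length (zigzagDiagrams m)
    ≡⟨ length-applyUpTo _ m ⟩
  m ∎
  where open ≡-Reasoning
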